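{- Let $D$ be a digraph and $v_0\in V(D)$ such that $d^+(v_0)\ge1$ and $d^+(v)\ge2$ for every $v\in V(D)\setminus\{v_0\}$. Then $D$ contains a subdivision of $\overleftrightarrow{K}_3-e$.
   Context: Digraphs are finite, loopless, without parallel arcs, but may contain digons. $d^+(v)$ denotes out-degree. $\overleftrightarrow{K}_3$ is the digraph on 3 vertices with both arcs $(u,v),(v,u)$ for each pair of distinct vertices; $\overleftrightarrow{K}_3-e$ is obtained by deleting one arc (all choices isomorphic). A subdivision of a digraph $F$ is obtained by replacing each arc $(x,y)$ by a directed $x$-$y$ path, paths for different arcs being internally vertex-disjoint. -}

module Defs where

open import Data.Nat using (ℕ; _+_)
open import Data.Fin using (Fin)
open import Data.Bool using (Bool; true; false; if_then_else_; T)
open import Data.List using (List; []; _∷_; _++_; map; allFin)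
open import Data.Nat.ListAction using (sum)
open import Data.List.Relation.Unary.Unique.Propositional using (Unique)
open import Data.Product using (Σ; ∃; _×_; _,_)
open import Relation.Binary.PropositionalEquality using (_≡_)

-- A Boolean relation has no parallel arcs by construction;
-- digons (arcs both ways) are allowed; loops are forbidden.
record Digraph : Set where
  field
    n        : ℕ
    arc      : Fin n → Fin n → Bool
    loopless : ∀ v → arc v v ≡ false
open Digraph public

outdeg : (D : Digraph) → Fin (n D) → ℕ
outdeg D v = sum (map (λ w → if arc D v w then 1 else 0) (allFin (n D)))

PathArcs : (D : Digraph) → Fin (n D) → List (Fin (n D)) → Fin (n D) → Set
PathArcs D x []       z = T (arc D x z)
PathArcs D x (y ∷ ys) z = T (arc D x y) × PathArcs D y ys z

-- K3 ↔ minus an arc: vertices a b c with arcs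
--   a→b, b→a, b→c, c→b, a→c   (the arc c→a is deleted).
-- A subdivision in D: distinct branch vertices a b c in D and, for each of
-- the five arcs (x,y), a directed x-y path in D given by its list of
-- internal vertices; all branch vertices and all internal vertices of all
-- paths are pairwise distinct (so each path is a genuine path and the paths
-- are internally vertex-disjoint and avoid the other branch vertices).
record SubdivK3e (D : Digraph) : Set where
  field
    a b c : Fin (n D)
    pab pba pbc pcb pac : List (Fin (n D))
    arcs-ab : PathArcs D a pab b
    arcs-ba : PathArcs D b pba a
    arcs-bc : PathArcs D b pbc c
    arcs-cb : PathArcs D c pcb b
    arcs-ac : PathArcs D a pac c
    distinct : Unique (a ∷ b ∷ c ∷ (pab ++ pba ++ pbc ++ pcb ++ pac))

module Submission where

-- Choose one out-neighbour of v₀ and two of every other vertex.  Such a "core"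
-- (alive vertices, a root with one chosen out-neighbour, all others with two) has
-- 2k − 1 arcs on k alive vertices, so some alive vertex y receives at most one arc.
-- Each case either exhibits the subdivision or yields a core with fewer alive
-- vertices whose subdivisions lift back (a "reduction"):
--   • y has no in-neighbour: delete y;
--   • y is the root with sole in-neighbour x: delete y, x becomes the root;
--   • y ≠ root has sole in-neighbour x: contract x → y into x, letting x point to
--     an out-neighbour y′ of y instead of y; a subdivision of the contracted core
--     lifts by subdividing the arc x → y′ at y.  This fails only if y points exactly
--     to x and to the other out-neighbour x₁ of x: then a path from x₁ to x closes
--     a subdivision on y, x, x₁, and otherwise the vertices reachable from x₁ form
--     a smaller core.

open import Defs
open import Data.Nat using (_≤_)
open import Data.Fin using (Fin)
open import Relation.Binary.PropositionalEquality using (_≢_)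

open import Data.Bool using (Bool; true; false; if_then_else_; T; not; _∧_; _∨_)
open import Data.Bool.Properties using (T-∧; T-∨)
open import Data.Empty using (⊥; ⊥-elim)
open import Data.Fin using (zero; suc)
open import Data.Fin.Properties using (_≟_; suc-injective; any?)
open import Data.List using (List; []; _∷_; _++_; [_]; concat; map; tabulate)
open import Data.List.Properties using (map-tabulate; ++-identityʳ)
open import Data.List.Membership.Propositional using (_∈_; _∉_)
open import Data.List.Membership.Propositional.Properties
  using (∈-++⁺ˡ; ∈-++⁺ʳ; ∈-++⁻; ∈-concat⁺′; ∈-map⁺)
open import Data.List.Relation.Unary.Any using (Any; here; there)
open import Data.List.Relation.Unary.All as All using (All; []; _∷_)
import Data.List.Relation.Unary.All.Properties as All
open import Data.List.Relation.Unary.AllPairs as AllPairs using (AllPairs; []; _∷_)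
open import Data.List.Relation.Unary.Unique.Propositional using (Unique)
import Data.List.Relation.Unary.Unique.Propositional.Properties as Unique
open import Data.List.Relation.Binary.Disjoint.Propositional using (Disjoint)
open import Data.List.Relation.Binary.Permutation.Propositional
  using (_↭_; ↭-refl; ↭-prep; ↭-swap; ↭-trans; ↭-sym; ↭⇒↭ₛ)
open import Data.List.Relation.Binary.Permutation.Propositional.Properties using (∈-resp-↭)
import Data.List.Relation.Binary.Permutation.Setoid.Properties as PermutationSetoid
open import Data.Nat using (ℕ; zero; suc; _+_; _*_; _<_; _≤?_; z≤n; s≤s; s≤s⁻¹)
open import Data.Nat.Induction using (<-wellFounded)
open import Data.Nat.ListAction using (sum)
open import Data.Nat.Properties
  using ( +-0-commutativeMonoid; +-mono-≤; +-mono-<-≤; +-mono-≤-<; +-monoʳ-≤; +-comm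
        ; m≤m+n; m≤n+m; ≤-refl; ≤-trans; ≤-reflexive; n≮n; ≰⇒>; module ≤-Reasoning)
open import Data.Product using (Σ; ∃; ∃₂; _×_; _,_; proj₁; proj₂)
import Data.Product as Product
open import Data.Sum as Sum using (_⊎_; inj₁; inj₂)
open import Data.Unit using (tt)
open import Function using (id; _∘_; Equivalence)
open import Induction.WellFounded using (Acc; acc)
open import Relation.Binary.PropositionalEquality
  using (_≡_; refl; sym; trans; cong; subst; setoid; module ≡-Reasoning)
open import Relation.Nullary using (¬_; Dec; yes; no; does; ¬?; _×-dec_; _⊎-dec_)
open import Relation.Nullary.Decidable
  using (T?; isYes; isNo; toWitness; fromWitness; toWitnessFalse; fromWitnessFalse)

open import Algebra.Properties.CommutativeMonoid.Sum +-0-commutativeMonoid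
  using (sum-cong-≗; ∑-distrib-+; ∑-comm; sum-replicate-zero)
  renaming (sum to ∑)

indicator : Bool → ℕ
indicator b = if b then 1 else 0

∧-intro : ∀ {a b} → T a → T b → T (a ∧ b)
∧-intro ta tb = Equivalence.from T-∧ (ta , tb)

∧-fst : ∀ {a b} → T (a ∧ b) → T a
∧-fst {a} t = proj₁ (Equivalence.to (T-∧ {a}) t)

∧-snd : ∀ {a b} → T (a ∧ b) → T b
∧-snd {a} t = proj₂ (Equivalence.to (T-∧ {a}) t)

δ : ∀ {n} → Fin n → Fin n → ℕ
δ i j = indicator (does (i ≟ j))

δ-self : ∀ {n} (i : Fin n) → δ i i ≡ 1
δ-self i with i ≟ i
... | yes _   = refl
... | no  i≢i = ⊥-elim (i≢i refl)

∑-δ : ∀ {n} (j : Fin n) → ∑ (λ i → δ i j) ≡ 1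
∑-δ {suc n} zero    = cong suc (sum-replicate-zero n)
∑-δ {suc n} (suc j) = ∑-δ j

∑-mono-≤ : ∀ {n} {f g : Fin n → ℕ} → (∀ i → f i ≤ g i) → ∑ f ≤ ∑ g
∑-mono-≤ {zero}  f≤g = z≤n
∑-mono-≤ {suc n} f≤g = +-mono-≤ (f≤g zero) (∑-mono-≤ (λ i → f≤g (suc i)))

∑-mono-< : ∀ {n} {f g : Fin n → ℕ} → (∀ i → f i ≤ g i) → ∀ j → f j < g j → ∑ f < ∑ g
∑-mono-< f≤g zero    fj<gj = +-mono-<-≤ fj<gj (∑-mono-≤ (λ i → f≤g (suc i)))
∑-mono-< f≤g (suc j) fj<gj = +-mono-≤-< (f≤g zero) (∑-mono-< (λ i → f≤g (suc i)) j fj<gj)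

term≤∑ : ∀ {n} (f : Fin n → ℕ) i → f i ≤ ∑ f
term≤∑ f zero    = m≤m+n _ _
term≤∑ f (suc i) = ≤-trans (term≤∑ (λ k → f (suc k)) i) (m≤n+m _ _)

two-terms≤∑ : ∀ {n} (f : Fin n → ℕ) {i j} → i ≢ j → f i + f j ≤ ∑ f
two-terms≤∑ f {zero}  {zero}  i≢j = ⊥-elim (i≢j refl)
two-terms≤∑ f {zero}  {suc j} i≢j = +-monoʳ-≤ (f zero) (term≤∑ (λ k → f (suc k)) j)
two-terms≤∑ f {suc i} {zero}  i≢j =
  subst (_≤ ∑ f) (+-comm (f zero) (f (suc i))) (+-monoʳ-≤ (f zero) (term≤∑ (λ k → f (suc k)) i))
two-terms≤∑ f {suc i} {suc j} i≢j =
  ≤-trans (two-terms≤∑ (λ k → f (suc k)) (λ e → i≢j (cong suc e))) (m≤n+m _ _)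

one-true : ∀ {n} (p : Fin n → Bool) → 1 ≤ ∑ (λ i → indicator (p i)) → ∃ λ i → T (p i)
one-true {suc n} p 1≤ with p zero in p₀
... | true  = zero , subst T (sym p₀) tt
... | false with one-true (λ i → p (suc i)) 1≤
...   | i , pi = suc i , pi

two-true : ∀ {n} (p : Fin n → Bool) → 2 ≤ ∑ (λ i → indicator (p i))
         → ∃₂ λ i j → i ≢ j × T (p i) × T (p j)
two-true {suc n} p 2≤ with p zero in p₀
... | true with one-true (λ i → p (suc i)) (s≤s⁻¹ 2≤)
...   | j , pj = zero , suc j , (λ ()) , subst T (sym p₀) tt , pj
two-true {suc n} p 2≤ | false with two-true (λ i → p (suc i)) 2≤
...   | i , j , i≢j , pi , pj = suc i , suc j , (λ e → i≢j (suc-injective e)) , pi , pj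

-- Walks, routes and subdivisions along an arbitrary relation on V

module _ {V : Set} where

  unique-++⁻ : ∀ (xs : List V) {ys} → Unique (xs ++ ys) → Unique xs × Unique ys × Disjoint xs ys
  unique-++⁻ []       u         = [] , u , λ ()
  unique-++⁻ (x ∷ xs) (x∉ ∷ u) with unique-++⁻ xs u
  ... | uxs , uys , xs#ys =
    All.++⁻ˡ xs x∉ ∷ uxs , uys ,
    λ { (here refl , v∈ys) → All.lookup (All.++⁻ʳ xs x∉) v∈ys refl
      ; (there v∈xs , v∈ys) → xs#ys (v∈xs , v∈ys) }

  unique-∷ : ∀ {x : V} {xs} → x ∉ xs → Unique xs → Unique (x ∷ xs)
  unique-∷ {xs = xs} x∉ u = All.¬Any⇒All¬ xs x∉ ∷ u

  unique-resp-↭ : ∀ {xs ys : List V} → xs ↭ ys → Unique xs → Unique ys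
  unique-resp-↭ p = PermutationSetoid.Unique-resp-↭ (setoid V) (↭⇒↭ₛ p)

  Path : (V → V → Set) → V → List V → V → Set
  Path R s []       t = R s t
  Path R s (m ∷ ms) t = R s m × Path R m ms t

  path-map : ∀ {R R′ : V → V → Set} → (∀ {u w} → R u w → R′ u w)
           → ∀ {s} ps {t} → Path R s ps t → Path R′ s ps t
  path-map f []       st       = f st
  path-map f (m ∷ ms) (sm , p) = f sm , path-map f ms p

  path-snoc : ∀ {R : V → V → Set} {s} ps {v t} → Path R s ps v → R v t → Path R s (ps ++ [ v ]) t
  path-snoc []       sv       vt = sv , vt
  path-snoc (m ∷ ms) (sm , p) vt = sm , path-snoc ms p vt

  path-out-arc : ∀ {R : V → V → Set} {s} ps {t v} → Path R s ps t → v ∈ s ∷ ps → ∃ (R v)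
  path-out-arc []       st       (here refl) = _ , st
  path-out-arc (m ∷ ms) (sm , p) (here refl) = _ , sm
  path-out-arc (m ∷ ms) (sm , p) (there v∈) = path-out-arc ms p v∈

  avoids-via : ∀ {R : V → V → Set} {x y} → (∀ {u} → R u y → u ≡ x)
             → ∀ {s} ps {t} → x ∉ s ∷ ps → Path R s ps t → y ∉ ps
  avoids-via only-x (m ∷ ms) x∉ (sm , p) (here refl) = x∉ (here (sym (only-x sm)))
  avoids-via only-x (m ∷ ms) x∉ (sm , p) (there y∈) = avoids-via only-x ms (x∉ ∘ there) p y∈

  ArcOn : V → List V → V → V → V → Set
  ArcOn s []       t u w = u ≡ s × w ≡ t
  ArcOn s (m ∷ ms) t u w = (u ≡ s × w ≡ m) ⊎ ArcOn m ms t u w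

  next : List V → V → V
  next []      t = t
  next (m ∷ _) t = m

  arcOn-tail : ∀ {s} ps {t u w} → ArcOn s ps t u w → (u ≡ s × w ≡ next ps t) ⊎ u ∈ ps
  arcOn-tail []       e        = inj₁ e
  arcOn-tail (m ∷ ms) (inj₁ e) = inj₁ e
  arcOn-tail (m ∷ ms) (inj₂ a) with arcOn-tail ms a
  ... | inj₁ (refl , _) = inj₂ (here refl)
  ... | inj₂ u∈ms       = inj₂ (there u∈ms)

  same-next : ∀ (ps₁ ps₂ : List V) {t₁ t₂} → Disjoint ps₁ ps₂ → t₁ ∉ ps₂ → t₂ ∉ ps₁
            → next ps₁ t₁ ≡ next ps₂ t₂ → t₁ ≡ t₂
  same-next []      []       _       _   _   e    = e
  same-next []      (m ∷ _)  _       t₁∉ _   refl = ⊥-elim (t₁∉ (here refl))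
  same-next (m ∷ _) []       _       _   t₂∉ refl = ⊥-elim (t₂∉ (here refl))
  same-next (m ∷ _) (m′ ∷ _) ps₁#ps₂ _   _   refl = ⊥-elim (ps₁#ps₂ (here refl , here refl))

  shared-arc : ∀ {s₁ ps₁ t₁ s₂ ps₂ t₂ u w} → Disjoint ps₁ ps₂
             → s₁ ∉ ps₂ → s₂ ∉ ps₁ → t₁ ∉ ps₂ → t₂ ∉ ps₁
             → ArcOn s₁ ps₁ t₁ u w → ArcOn s₂ ps₂ t₂ u w → s₁ ≡ s₂ × t₁ ≡ t₂
  shared-arc {ps₁ = ps₁} {ps₂ = ps₂} ps₁#ps₂ s₁∉ s₂∉ t₁∉ t₂∉ a₁ a₂
    with arcOn-tail ps₁ a₁ | arcOn-tail ps₂ a₂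
  ... | inj₂ u∈₁           | inj₂ u∈₂         = ⊥-elim (ps₁#ps₂ (u∈₁ , u∈₂))
  ... | inj₂ u∈₁           | inj₁ (refl , _)  = ⊥-elim (s₂∉ u∈₁)
  ... | inj₁ (refl , _)    | inj₂ u∈₂         = ⊥-elim (s₁∉ u∈₂)
  ... | inj₁ (refl , refl) | inj₁ (refl , w≡) = refl , same-next ps₁ ps₂ ps₁#ps₂ t₁∉ t₂∉ w≡

  record Route : Set where
    constructor route
    field
      src : V
      mid : List V
      tgt : V
  open Route

  RoutePath : (V → V → Set) → Route → Set
  RoutePath R r = Path R (src r) (mid r) (tgt r)

  Uses : Route → V → V → Set
  Uses r = ArcOn (src r) (mid r) (tgt r)

  record SameEnds (r₁ r₂ : Route) : Set where
    constructor same-ends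
    field
      same-src : src r₁ ≡ src r₂
      same-tgt : tgt r₁ ≡ tgt r₂

  ArcDisjoint : Route → Route → Set
  ArcDisjoint r₁ r₂ = ∀ {u w} → Uses r₁ u w → Uses r₂ u w → ⊥

  interior : List Route → List V
  interior rs = concat (map mid rs)

  mid⊆interior : ∀ {rs r v} → r ∈ rs → v ∈ mid r → v ∈ interior rs
  mid⊆interior r∈ v∈ = ∈-concat⁺′ v∈ (∈-map⁺ mid r∈)

  interior-out-arc : ∀ {R : V → V → Set} {rs v} → All (RoutePath R) rs → v ∈ interior rs → ∃ (R v)
  interior-out-arc {rs = r ∷ _} (p ∷ ps) v∈ with ∈-++⁻ (mid r) v∈
  ... | inj₁ v∈r  = path-out-arc (mid r) p (there v∈r)
  ... | inj₂ v∈rs = interior-out-arc ps v∈rs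

  routes-simple : ∀ rs → Unique (interior rs) → All (λ r → src r ∉ interior rs) rs
                → All (λ r → Unique (src r ∷ mid r)) rs
  routes-simple []       _ _           = []
  routes-simple (r ∷ rs) u (s∉ ∷ srcs) with unique-++⁻ (mid r) u
  ... | ur , urs , _ =
    unique-∷ (s∉ ∘ ∈-++⁺ˡ) ur ∷ routes-simple rs urs (All.map (_∘ ∈-++⁺ʳ (mid r)) srcs)

  routes-arc-disjoint : ∀ rs → Unique (interior rs)
                      → All (λ r → src r ∉ interior rs × tgt r ∉ interior rs) rs
                      → AllPairs (λ r₁ r₂ → ¬ SameEnds r₁ r₂) rs → AllPairs ArcDisjoint rs
  routes-arc-disjoint []       _ _ _ = []
  routes-arc-disjoint (r ∷ rs) u ((s∉ , t∉) ∷ ends) (r≁rs ∷ distinct-ends)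
    with unique-++⁻ (mid r) u
  ... | _ , urs , r#rs =
    All.zipWith arc-disjoint (r≁rs , All.tabulate id)
    ∷ routes-arc-disjoint rs urs (All.map (Product.map (_∘ ∈-++⁺ʳ (mid r)) (_∘ ∈-++⁺ʳ (mid r))) ends)
        distinct-ends
    where
    arc-disjoint : ∀ {r′} → ¬ SameEnds r r′ × r′ ∈ rs → ArcDisjoint r r′
    arc-disjoint (r≁r′ , r′∈) a₁ a₂ = r≁r′ (Product.uncurry same-ends (shared-arc
      (λ (v∈r , v∈r′) → r#rs (v∈r , mid⊆interior r′∈ v∈r′))
      (s∉ ∘ ∈-++⁺ʳ (mid r) ∘ mid⊆interior r′∈) (proj₁ (All.lookup ends r′∈) ∘ ∈-++⁺ˡ)
      (t∉ ∘ ∈-++⁺ʳ (mid r) ∘ mid⊆interior r′∈) (proj₂ (All.lookup ends r′∈) ∘ ∈-++⁺ˡ)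
      a₁ a₂))

  record Subdivision (R : V → V → Set) : Set where
    field
      a b c : V
      pab pba pbc pcb pac : List V
      arcs-ab : Path R a pab b
      arcs-ba : Path R b pba a
      arcs-bc : Path R b pbc c
      arcs-cb : Path R c pcb b
      arcs-ac : Path R a pac c
      distinct : Unique (a ∷ b ∷ c ∷ concat (pab ∷ pba ∷ pbc ∷ pcb ∷ pac ∷ []))

    branches : List V
    branches = a ∷ b ∷ c ∷ []

    routes : List Route
    routes = route a pab b ∷ route b pba a ∷ route b pbc c ∷ route c pcb b ∷ route a pac c ∷ []

    route-paths : All (RoutePath R) routes
    route-paths = arcs-ab ∷ arcs-ba ∷ arcs-bc ∷ arcs-cb ∷ arcs-ac ∷ []

    branches-unique : Unique branches
    branches-unique = proj₁ (unique-++⁻ branches distinct)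

    interior-unique : Unique (interior routes)
    interior-unique = proj₁ (proj₂ (unique-++⁻ branches distinct))

    branches-outside : Disjoint branches (interior routes)
    branches-outside = proj₂ (proj₂ (unique-++⁻ branches distinct))

    vertex-out-arc : ∀ {v} → v ∈ branches ++ interior routes → ∃ (R v)
    vertex-out-arc (here refl)                 = path-out-arc pab arcs-ab (here refl)
    vertex-out-arc (there (here refl))         = path-out-arc pba arcs-ba (here refl)
    vertex-out-arc (there (there (here refl))) = path-out-arc pcb arcs-cb (here refl)
    vertex-out-arc (there (there (there v∈)))  = interior-out-arc route-paths v∈

    private
      outside : ∀ {v} → v ∈ branches → v ∉ interior routes
      outside v∈B v∈I = branches-outside (v∈B , v∈I)

      ends-outside : All (λ r → src r ∉ interior routes × tgt r ∉ interior routes) routes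
      ends-outside =
          (outside (here refl) , outside (there (here refl)))
        ∷ (outside (there (here refl)) , outside (here refl))
        ∷ (outside (there (here refl)) , outside (there (there (here refl))))
        ∷ (outside (there (there (here refl))) , outside (there (here refl)))
        ∷ (outside (here refl) , outside (there (there (here refl))))
        ∷ []

      a≢b : a ≢ b
      a≢b = All.head (AllPairs.head distinct)
      a≢c : a ≢ c
      a≢c = All.head (All.tail (AllPairs.head distinct))
      b≢c : b ≢ c
      b≢c = All.head (AllPairs.head (AllPairs.tail distinct))

      src≢ : ∀ {r₁ r₂} → src r₁ ≢ src r₂ → ¬ SameEnds r₁ r₂
      src≢ n (same-ends e _) = n e
      tgt≢ : ∀ {r₁ r₂} → tgt r₁ ≢ tgt r₂ → ¬ SameEnds r₁ r₂
      tgt≢ n (same-ends _ e) = n e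

    routes-are-paths : All (λ r → Unique (src r ∷ mid r)) routes
    routes-are-paths = routes-simple routes interior-unique (All.map proj₁ ends-outside)

    -- the five routes join five different ordered pairs, so no arc is used twice
    routes-share-no-arc : AllPairs ArcDisjoint routes
    routes-share-no-arc = routes-arc-disjoint routes interior-unique ends-outside
      (  (src≢ a≢b ∷ src≢ a≢b ∷ src≢ a≢c ∷ tgt≢ b≢c ∷ [])
       ∷ (tgt≢ a≢c ∷ src≢ b≢c ∷ src≢ (a≢b ∘ sym) ∷ [])
       ∷ (src≢ b≢c ∷ src≢ (a≢b ∘ sym) ∷ [])
       ∷ (src≢ (a≢c ∘ sym) ∷ [])
       ∷ [] ∷ [])

  subdivision-map : ∀ {R R′ : V → V → Set} → (∀ {u w} → R u w → R′ u w)
                  → Subdivision R → Subdivision R′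
  subdivision-map f F = record
    { a = a ; b = b ; c = c ; pab = pab ; pba = pba ; pbc = pbc ; pcb = pcb ; pac = pac
    ; arcs-ab = path-map f pab arcs-ab ; arcs-ba = path-map f pba arcs-ba ; arcs-bc = path-map f pbc arcs-bc
    ; arcs-cb = path-map f pcb arcs-cb ; arcs-ac = path-map f pac arcs-ac ; distinct = distinct }
    where open Subdivision F

  -- Subdividing an arc.  E′ consists of arcs of E and possibly the arc x → y′,
  -- which E replaces by the walk x → y → y′.
  module Lifting (E E′ : V → V → Set) (E? : ∀ u w → Dec (E u w)) {x y y′ : V}
    (E′⊆E+xy′ : ∀ {u w} → E′ u w → E u w ⊎ (u ≡ x × w ≡ y′))
    (x→y : E x y) (y→y′ : E y y′) where

    record Lifted (r : Route) : Set where
      field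
        mid′   : List V
        path′  : Path E (src r) mid′ (tgt r)
        change : mid′ ≡ mid r ⊎ (Uses r x y′ × mid′ ↭ y ∷ mid r)
    open Lifted

    old-arc : ∀ {u w} → u ≢ x → E′ u w → E u w
    old-arc u≢x uw with E′⊆E+xy′ uw
    ... | inj₁ e         = e
    ... | inj₂ (u≡x , _) = ⊥-elim (u≢x u≡x)

    old-arcs : ∀ {s} ps {t} → x ∉ s ∷ ps → Path E′ s ps t → Path E s ps t
    old-arcs []       x∉ st       = old-arc (x∉ ∘ here ∘ sym) st
    old-arcs (m ∷ ms) x∉ (sm , p) = old-arc (x∉ ∘ here ∘ sym) sm , old-arcs ms (x∉ ∘ there) p

    prepend : ∀ {s m ms t} → E s m → Lifted (route m ms t) → Lifted (route s (m ∷ ms) t)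
    prepend {m = m} sm l = record
      { mid′   = m ∷ mid′ l
      ; path′  = sm , path′ l
      ; change = Sum.map (cong (m ∷_)) (Product.map inj₂ (λ p → ↭-trans (↭-prep m p) (↭-swap m y ↭-refl)))
                   (change l) }

    -- every path along E′ lifts; being a path, it uses x → y′ at most once
    lift-path : ∀ s ps t → Unique (s ∷ ps) → Path E′ s ps t → Lifted (route s ps t)
    lift-path s [] t _ st with E? s t
    ... | yes e = record { mid′ = [] ; path′ = e ; change = inj₁ refl }
    ... | no ¬e with E′⊆E+xy′ st
    ...   | inj₁ e             = ⊥-elim (¬e e)
    ...   | inj₂ (refl , refl) =
      record { mid′ = y ∷ [] ; path′ = x→y , y→y′ ; change = inj₂ ((refl , refl) , ↭-refl) }
    lift-path s (m ∷ ms) t (s∉ ∷ u) (sm , p) with E? s m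
    ... | yes e = prepend e (lift-path m ms t u p)
    ... | no ¬e with E′⊆E+xy′ sm
    ...   | inj₁ e             = ⊥-elim (¬e e)
    ...   | inj₂ (refl , refl) = record
      { mid′   = y ∷ m ∷ ms
      ; path′  = x→y , y→y′ , old-arcs ms (Unique.Unique[x∷xs]⇒x∉xs (s∉ ∷ u)) p
      ; change = inj₂ (inj₁ (refl , refl) , ↭-refl) }

    lifted-∈ : ∀ {r} (l : Lifted r) {v} → v ∈ mid′ l → v ∈ mid r ⊎ (v ≡ y × Uses r x y′)
    lifted-∈ l v∈ with change l
    ... | inj₁ mid′≡mid       = inj₁ (subst (_ ∈_) mid′≡mid v∈)
    ... | inj₂ (uses , mid′↭) with ∈-resp-↭ mid′↭ v∈
    ...   | here v≡y  = inj₂ (v≡y , uses)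
    ...   | there v∈r = inj₁ v∈r

    lifted-unique : ∀ {r} (l : Lifted r) → Unique (mid r) → y ∉ mid r → Unique (mid′ l)
    lifted-unique l u y∉ with change l
    ... | inj₁ mid′≡mid     = subst Unique (sym mid′≡mid) u
    ... | inj₂ (_ , mid′↭) = unique-resp-↭ (↭-sym mid′↭) (unique-∷ y∉ u)

    lifted-interior : ∀ {rs} → All Lifted rs → List V
    lifted-interior ls = concat (All.reduce mid′ ls)

    ∈-lifted-interior : ∀ {rs} (ls : All Lifted rs) {v} → v ∈ lifted-interior ls
                      → v ∈ interior rs ⊎ (v ≡ y × Any (λ r → Uses r x y′) rs)
    ∈-lifted-interior (l ∷ ls) v∈ with ∈-++⁻ (mid′ l) v∈
    ... | inj₁ v∈l with lifted-∈ l v∈l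
    ...   | inj₁ v∈r          = inj₁ (∈-++⁺ˡ v∈r)
    ...   | inj₂ (v≡y , uses) = inj₂ (v≡y , here uses)
    ∈-lifted-interior {r ∷ _} (l ∷ ls) v∈ | inj₂ v∈ls with ∈-lifted-interior ls v∈ls
    ...   | inj₁ v∈I          = inj₁ (∈-++⁺ʳ (mid r) v∈I)
    ...   | inj₂ (v≡y , uses) = inj₂ (v≡y , there uses)

    -- lifting a family that uses every arc at most once keeps its interior
    -- vertices distinct: y is inserted into at most one route
    lifted-interior-unique : ∀ {rs} (ls : All Lifted rs) → Unique (interior rs) → y ∉ interior rs
                           → AllPairs ArcDisjoint rs → Unique (lifted-interior ls)
    lifted-interior-unique []                _ _  _                  = []
    lifted-interior-unique {r ∷ rs} (l ∷ ls) u y∉ (r#rs ∷ disjoint) with unique-++⁻ (mid r) u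
    ... | ur , urs , r#rest =
      Unique.++⁺ (lifted-unique l ur (y∉ ∘ ∈-++⁺ˡ))
                 (lifted-interior-unique ls urs (y∉ ∘ ∈-++⁺ʳ (mid r)) disjoint)
                 separated
      where
      separated : Disjoint (mid′ l) (lifted-interior ls)
      separated (v∈l , v∈ls) with lifted-∈ l v∈l | ∈-lifted-interior ls v∈ls
      ... | inj₁ v∈r        | inj₁ v∈I         = r#rest (v∈r , v∈I)
      ... | inj₁ v∈r        | inj₂ (refl , _)  = y∉ (∈-++⁺ˡ v∈r)
      ... | inj₂ (refl , _) | inj₁ v∈I         = y∉ (∈-++⁺ʳ (mid r) v∈I)
      ... | inj₂ (_ , uses) | inj₂ (_ , uses′) = All.lookupWith (λ r#r′ → r#r′ uses) r#rs uses′

    -- If y has no out-arc along E′ (so lies on no E′-subdivision), every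
    -- E′-subdivision lifts to an E-subdivision.
    lift-subdivision : (∀ {w} → ¬ E′ y w) → Subdivision E′ → Subdivision E
    lift-subdivision y-sink F = assemble lifts distinct′
      where
      open Subdivision F

      lifts : All Lifted routes
      lifts = All.zipWith (λ {r} (u , p) → lift-path (src r) (mid r) (tgt r) u p) (routes-are-paths , route-paths)

      y∉ : y ∉ branches ++ interior routes
      y∉ y∈ = y-sink (proj₂ (vertex-out-arc y∈))

      separated : Disjoint branches (lifted-interior lifts)
      separated (v∈B , v∈I′) with ∈-lifted-interior lifts v∈I′
      ... | inj₁ v∈I        = branches-outside (v∈B , v∈I)
      ... | inj₂ (refl , _) = y∉ (∈-++⁺ˡ v∈B)

      distinct′ : Unique (branches ++ lifted-interior lifts)
      distinct′ = Unique.++⁺ branches-unique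
        (lifted-interior-unique lifts interior-unique (y∉ ∘ ∈-++⁺ʳ branches) routes-share-no-arc) separated

      assemble : (ls : All Lifted routes) → Unique (branches ++ lifted-interior ls) → Subdivision E
      assemble (l₁ ∷ l₂ ∷ l₃ ∷ l₄ ∷ l₅ ∷ []) u = record
        { a = a ; b = b ; c = c
        ; pab = mid′ l₁ ; pba = mid′ l₂ ; pbc = mid′ l₃ ; pcb = mid′ l₄ ; pac = mid′ l₅
        ; arcs-ab = path′ l₁ ; arcs-ba = path′ l₂ ; arcs-bc = path′ l₃
        ; arcs-cb = path′ l₄ ; arcs-ac = path′ l₅
        ; distinct = u }

-- Reachability by search.  Starting from s, either find a path from s to t or a
-- set of vertices containing s, not t, and closed under R.
module Reachability {N : ℕ} (R : Fin N → Fin N → Set) (R? : ∀ u w → Dec (R u w))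
  (s t : Fin N) (s≢t : s ≢ t) where

  SimplePath : Fin N → Set
  SimplePath v = Σ (List (Fin N)) λ ps → Path R s ps v × Unique (s ∷ ps) × v ∉ s ∷ ps

  Closed : (Fin N → Bool) → Set
  Closed S = ∀ {v w} → T (S v) → R v w → T (S w)

  Outcome : Set
  Outcome = SimplePath t ⊎ Σ (Fin N → Bool) λ S → T (S s) × ¬ T (S t) × Closed S

  record Reached (visited : Fin N → Bool) (v : Fin N) : Set where
    field
      walk   : List (Fin N)
      path   : Path R s walk v
      simple : Unique (s ∷ walk)
      fresh  : v ∉ s ∷ walk
      inside : All (T ∘ visited) (s ∷ walk)

  record Explored (visited : Fin N → Bool) : Set where
    field
      source  : T (visited s)
      target  : ¬ T (visited t)
      reached : ∀ {v} → T (visited v) → v ≢ s → Reached visited v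

  reached-mono : ∀ {visited visited′ : Fin N → Bool} → (∀ {z} → T (visited z) → T (visited′ z))
               → ∀ {v} → Reached visited v → Reached visited′ v
  reached-mono ⊆′ r = record { Reached r ; inside = All.map ⊆′ (Reached.inside r) }

  extend : ∀ {visited} → Explored visited
         → ∀ {v w} → T (visited v) → R v w → ¬ T (visited w) → Reached visited w
  extend E {v} {w} vis-v vw w-new with v ≟ s
  ... | yes refl = record
    { walk = [] ; path = vw ; simple = [] ∷ []
    ; fresh = λ { (here refl) → w-new (Explored.source E) } ; inside = Explored.source E ∷ [] }
  ... | no v≢s = record
    { walk   = walk ++ [ v ]
    ; path   = path-snoc walk path vw
    ; simple = Unique.++⁺ simple ([] ∷ []) (λ { (v∈ , here refl) → fresh v∈ })
    ; fresh  = λ w∈ → w-new (All.lookup inside′ w∈)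
    ; inside = inside′ }
    where
    open Reached (Explored.reached E vis-v v≢s)
    inside′ : All (T ∘ _) (s ∷ walk ++ [ v ])
    inside′ = All.++⁺ inside (vis-v ∷ [])

  add : (Fin N → Bool) → Fin N → Fin N → Bool
  add visited w z = visited z ∨ isYes (z ≟ w)

  add-grows : ∀ visited w {z} → T (visited z) → T (add visited w z)
  add-grows _ _ vis-z = Equivalence.from T-∨ (inj₁ vis-z)

  visit : ∀ {visited} → Explored visited → ∀ {v w} → T (visited v) → R v w → ¬ T (visited w) → w ≢ t
        → Explored (add visited w)
  visit {visited} E {v} {w} vis-v vw w-new w≢t = record
    { source = add-grows visited w (Explored.source E) ; target = target′ ; reached = reached′ }
    where
    target′ : ¬ T (add visited w t)
    target′ vis′-t with Equivalence.to T-∨ vis′-t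
    ... | inj₁ vis-t = Explored.target E vis-t
    ... | inj₂ t≡w   = w≢t (sym (toWitness t≡w))
    reached′ : ∀ {z} → T (add visited w z) → z ≢ s → Reached (add visited w) z
    reached′ vis′-z z≢s with Equivalence.to T-∨ vis′-z
    ... | inj₁ vis-z = reached-mono (add-grows visited w) (Explored.reached E vis-z z≢s)
    ... | inj₂ z≡w with toWitness z≡w
    ...   | refl = reached-mono (add-grows visited w) (extend E vis-v vw w-new)

  unvisited : (Fin N → Bool) → ℕ
  unvisited visited = ∑ (λ v → indicator (not (visited v)))

  add-fewer : ∀ visited {w} → ¬ T (visited w) → unvisited (add visited w) < unvisited visited
  add-fewer visited {w} w-new =
    ∑-mono-< (λ z → unvisited-mono (visited z) _) w
      (unvisited-drops (visited w) _ w-new (fromWitness {a? = w ≟ w} refl))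
    where
    unvisited-mono : ∀ a b → indicator (not (a ∨ b)) ≤ indicator (not a)
    unvisited-mono true  _     = z≤n
    unvisited-mono false true  = z≤n
    unvisited-mono false false = ≤-refl
    unvisited-drops : ∀ a b → ¬ T a → T b → indicator (not (a ∨ b)) < indicator (not a)
    unvisited-drops false true _  _ = s≤s z≤n
    unvisited-drops true  _    ¬a _ = ⊥-elim (¬a tt)

  explore : ∀ visited → Acc _<_ (unvisited visited) → Explored visited → Outcome
  explore visited (acc smaller) E
    with any? (λ v → any? (λ w → T? (visited v) ×-dec R? v w ×-dec ¬? (T? (visited w))))
  ... | no no-exit = inj₂ (visited , Explored.source E , Explored.target E , closed)
    where
    closed : Closed visited
    closed {v} {w} vis-v vw with T? (visited w)
    ... | yes vis-w = vis-w
    ... | no  w-new = ⊥-elim (no-exit (v , w , vis-v , vw , w-new))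
  ... | yes (v , w , vis-v , vw , w-new) with w ≟ t
  ...   | yes refl = inj₁ (walk , path , simple , fresh)
    where open Reached (extend E vis-v vw w-new)
  ...   | no w≢t   = explore (add visited w) (smaller (add-fewer visited w-new)) (visit E vis-v vw w-new w≢t)

  reachability : Outcome
  reachability = explore start (<-wellFounded _) record
    { source  = fromWitness {a? = s ≟ s} refl
    ; target  = λ t∈ → s≢t (sym (toWitness t∈))
    ; reached = λ z∈ z≢s → ⊥-elim (z≢s (toWitness z∈)) }
    where
    start : Fin N → Bool
    start z = isYes (z ≟ s)

-- Cores: the chosen out-arcs of a set of alive vertices, and their reductions

module Cores (N : ℕ) where

  V : Set
  V = Fin N

  record Core : Set where
    field
      alive : V → Bool
      root  : V
      out₁ out₂ : V → V
      root-alive : T (alive root)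
      out₁-ok : ∀ v → T (alive v) → T (alive (out₁ v)) × out₁ v ≢ v
      out₂-ok : ∀ v → T (alive v) → v ≢ root → T (alive (out₂ v)) × out₂ v ≢ v × out₁ v ≢ out₂ v
  open Core

  Arc : Core → V → V → Set
  Arc K u w = T (alive K u) × (w ≡ out₁ K u ⊎ (u ≢ root K × w ≡ out₂ K u))

  arc? : ∀ K u w → Dec (Arc K u w)
  arc? K u w = T? (alive K u) ×-dec (w ≟ out₁ K u ⊎-dec (¬? (u ≟ root K) ×-dec w ≟ out₂ K u))

  first-arc : ∀ K {v} → T (alive K v) → Arc K v (out₁ K v)
  first-arc K al = al , inj₁ refl

  second-arc : ∀ K {v} → T (alive K v) → v ≢ root K → Arc K v (out₂ K v)
  second-arc K al v≢root = al , inj₂ (v≢root , refl)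

  arc-head : ∀ K {u w} → Arc K u w → T (alive K w) × w ≢ u
  arc-head K (al , inj₁ refl)            = out₁-ok K _ al
  arc-head K (al , inj₂ (u≢root , refl)) =
    proj₁ (out₂-ok K _ al u≢root) , proj₁ (proj₂ (out₂-ok K _ al u≢root))

  other-out : ∀ K {x y} → Arc K x y → x ≢ root K → ∃ λ x₁ → Arc K x x₁ × x₁ ≢ y
  other-out K {x} (al , inj₁ refl) x≢root =
    out₂ K x , second-arc K al x≢root , proj₂ (proj₂ (out₂-ok K x al x≢root)) ∘ sym
  other-out K {x} (al , inj₂ (_ , refl)) x≢root =
    out₁ K x , first-arc K al , proj₂ (proj₂ (out₂-ok K x al x≢root))

  out-avoiding : ∀ K {y} → T (alive K y) → y ≢ root K → (z : V) → ∃ λ y′ → Arc K y y′ × y′ ≢ z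
  out-avoiding K {y} al y≢root z with out₁ K y ≟ z
  ... | no out₁≢z = out₁ K y , first-arc K al , out₁≢z
  ... | yes out₁≡z = out₂ K y , second-arc K al y≢root ,
                     λ out₂≡z → proj₂ (proj₂ (out₂-ok K y al y≢root)) (trans out₁≡z (sym out₂≡z))

  third-neighbour : ∀ K {y} → T (alive K y) → y ≢ root K → (x x₁ : V)
                  → (∃ λ y′ → Arc K y y′ × y′ ≢ x × y′ ≢ x₁) ⊎ (Arc K y x × Arc K y x₁)
  third-neighbour K {y} al y≢root x x₁
    with out₁ K y ≟ x | out₁ K y ≟ x₁ | out₂ K y ≟ x | out₂ K y ≟ x₁
  ... | no n₁ | no n₂ | _     | _     = inj₁ (out₁ K y , first-arc K al , n₁ , n₂)
  ... | _     | _     | no n₁ | no n₂ = inj₁ (out₂ K y , second-arc K al y≢root , n₁ , n₂)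
  ... | yes p | _     | yes q | _     = ⊥-elim (proj₂ (proj₂ (out₂-ok K y al y≢root)) (trans p (sym q)))
  ... | _     | yes p | _     | yes q = ⊥-elim (proj₂ (proj₂ (out₂-ok K y al y≢root)) (trans p (sym q)))
  ... | yes p | no _  | no _  | yes q =
    inj₂ (subst (Arc K y) p (first-arc K al) , subst (Arc K y) q (second-arc K al y≢root))
  ... | no _  | yes p | yes q | no _  =
    inj₂ (subst (Arc K y) q (second-arc K al y≢root) , subst (Arc K y) p (first-arc K al))

  multiplicity : Core → V → V → ℕ
  multiplicity K u w =
    if alive K u then δ w (out₁ K u) + (if does (u ≟ root K) then 0 else δ w (out₂ K u)) else 0

  arc⇒multiplicity : ∀ K {u w} → Arc K u w → 1 ≤ multiplicity K u w
  arc⇒multiplicity K {u} {w} (al , chosen) with alive K u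
  ... | true = counted chosen
    where
    counted : w ≡ out₁ K u ⊎ (u ≢ root K × w ≡ out₂ K u)
            → 1 ≤ δ w (out₁ K u) + (if does (u ≟ root K) then 0 else δ w (out₂ K u))
    counted (inj₁ refl) rewrite δ-self w = s≤s z≤n
    counted (inj₂ (u≢root , refl)) with u ≟ root K
    ... | yes u≡root = ⊥-elim (u≢root u≡root)
    ... | no _ rewrite δ-self w = m≤n+m 1 _

  out-count : ∀ K u → ∑ (multiplicity K u) + δ u (root K) ≡ 2 * indicator (alive K u)
  out-count K u with alive K u in al | u ≟ root K
  ... | true  | yes refl
    rewrite ∑-distrib-+ (λ w → δ w (out₁ K u)) (λ _ → 0) | ∑-δ (out₁ K u) | sum-replicate-zero N = refl
  ... | true  | no _
    rewrite ∑-distrib-+ (λ w → δ w (out₁ K u)) (λ w → δ w (out₂ K u))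
          | ∑-δ (out₁ K u) | ∑-δ (out₂ K u) = refl
  ... | false | yes refl = ⊥-elim (subst T al (root-alive K))
  ... | false | no _ rewrite sum-replicate-zero N = refl

  arc-count : ∀ K → ∑ (λ u → ∑ (multiplicity K u)) + 1 ≡ ∑ (λ u → 2 * indicator (alive K u))
  arc-count K = begin
    ∑ out + 1                                      ≡⟨ cong (∑ out +_) (sym (∑-δ (root K))) ⟩
    ∑ out + ∑ (λ u → δ u (root K))                 ≡⟨ sym (∑-distrib-+ out (λ u → δ u (root K))) ⟩
    ∑ (λ u → out u + δ u (root K))                 ≡⟨ sum-cong-≗ (out-count K) ⟩
    ∑ (λ u → 2 * indicator (alive K u))            ∎
    where
    open ≡-Reasoning
    out : V → ℕ
    out u = ∑ (multiplicity K u)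

  in-count : Core → V → ℕ
  in-count K y = ∑ (λ u → multiplicity K u y)

  -- so some alive vertex receives at most one arc: counting arcs by their heads
  -- would otherwise give at least twice the number of alive vertices
  sparse-vertex : ∀ K → ∃ λ y → T (alive K y) × in-count K y ≤ 1
  sparse-vertex K with any? (λ y → T? (alive K y) ×-dec in-count K y ≤? 1)
  ... | yes found = found
  ... | no none   = ⊥-elim (n≮n _ (begin-strict
      ∑ (λ u → ∑ (multiplicity K u))      <⟨ ≤-reflexive (trans (+-comm 1 _) (arc-count K)) ⟩
      ∑ (λ u → 2 * indicator (alive K u)) ≤⟨ ∑-mono-≤ rich ⟩
      ∑ (in-count K)                      ≡⟨ ∑-comm (λ y u → multiplicity K u y) ⟩
      ∑ (λ u → ∑ (multiplicity K u))      ∎))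
    where
    open ≤-Reasoning
    rich : ∀ y → 2 * indicator (alive K y) ≤ in-count K y
    rich y with alive K y in al
    ... | true  = ≰⇒> (λ few → none (y , subst T (sym al) tt , few))
    ... | false = z≤n

  in-neighbours : ∀ K y → in-count K y ≤ 1
                → (∀ u → ¬ Arc K u y) ⊎ ∃ λ x → Arc K x y × (∀ {u} → Arc K u y → u ≡ x)
  in-neighbours K y sparse with any? (λ u → arc? K u y)
  ... | no none       = inj₁ (λ u u→y → none (u , u→y))
  ... | yes (x , x→y) = inj₂ (x , x→y , only-x)
    where
    only-x : ∀ {u} → Arc K u y → u ≡ x
    only-x {u} u→y with u ≟ x
    ... | yes u≡x = u≡x
    ... | no u≢x  = ⊥-elim (n≮n 1 (begin-strict
      1                                         <⟨ +-mono-≤ (arc⇒multiplicity K u→y) (arc⇒multiplicity K x→y) ⟩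
      multiplicity K u y + multiplicity K x y   ≤⟨ two-terms≤∑ (λ v → multiplicity K v y) u≢x ⟩
      in-count K y                              ≤⟨ sparse ⟩
      1                                         ∎))
      where open ≤-Reasoning

  size : Core → ℕ
  size K = ∑ (λ v → indicator (alive K v))

  record Reduction (K : Core) : Set where
    field
      smaller : Core
      shrinks : size smaller < size K
      lift    : Subdivision (Arc smaller) → Subdivision (Arc K)

  size-restrict : ∀ K (S : V → Bool) {z} → T (alive K z) → ¬ T (S z)
                → ∑ (λ v → indicator (alive K v ∧ S v)) < size K
  size-restrict K S {z} z-alive z∉S =
    ∑-mono-< (λ v → ∧-mono (alive K v) (S v)) z (∧-drop (alive K z) (S z) z-alive z∉S)
    where
    ∧-mono : ∀ a s → indicator (a ∧ s) ≤ indicator a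
    ∧-mono true  true  = ≤-refl
    ∧-mono true  false = z≤n
    ∧-mono false _     = z≤n
    ∧-drop : ∀ a s → T a → ¬ T s → indicator (a ∧ s) < indicator a
    ∧-drop true false _ _  = s≤s z≤n
    ∧-drop true true  _ ¬s = ⊥-elim (¬s tt)

  all-but : V → V → Bool
  all-but y v = isNo (v ≟ y)

  restrict : ∀ K (S : V → Bool) → (∀ {v w} → T (S v) → Arc K v w → T (S w))
           → ∀ {z} → T (alive K z) → ¬ T (S z)
           → ∀ {r} → T (alive K r) → T (S r) → (∀ {v} → T (S v) → v ≢ r → v ≢ root K)
           → Reduction K
  restrict K S closed z-alive z∉S {r} r-alive r∈S non-root = record
    { smaller = K′ ; shrinks = size-restrict K S z-alive z∉S ; lift = subdivision-map old-arc }
    where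
    K′ : Core
    K′ = record
      { alive = λ v → alive K v ∧ S v ; root = r ; out₁ = out₁ K ; out₂ = out₂ K
      ; root-alive = ∧-intro r-alive r∈S
      ; out₁-ok = λ v al′ →
          let al = ∧-fst al′ in
          ∧-intro (proj₁ (out₁-ok K v al)) (closed (∧-snd al′) (first-arc K al)) , proj₂ (out₁-ok K v al)
      ; out₂-ok = λ v al′ v≢r →
          let al = ∧-fst al′ ; v≢root = non-root (∧-snd al′) v≢r in
          ∧-intro (proj₁ (out₂-ok K v al v≢root)) (closed (∧-snd al′) (second-arc K al v≢root))
          , proj₂ (out₂-ok K v al v≢root) }
    old-arc : ∀ {u w} → Arc K′ u w → Arc K u w
    old-arc (al′ , inj₁ e)          = ∧-fst al′ , inj₁ e
    old-arc (al′ , inj₂ (u≢r , e)) = ∧-fst al′ , inj₂ (non-root (∧-snd al′) u≢r , e)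

  delete-source : ∀ K {y} → T (alive K y) → (∀ u → ¬ Arc K u y) → Reduction K
  delete-source K {y} y-alive no-in = with-root (y ≟ root K)
    where
    closed : ∀ {v w} → T (all-but y v) → Arc K v w → T (all-but y w)
    closed {v} _ v→w = fromWitnessFalse (λ { refl → no-in v v→w })

    with-root : Dec (y ≡ root K) → Reduction K
    with-root (no y≢root) =
      restrict K (all-but y) closed y-alive (λ y∈ → toWitnessFalse y∈ refl)
        (root-alive K) (fromWitnessFalse (y≢root ∘ sym)) (λ _ v≢root → v≢root)
    with-root (yes y≡root) =
      restrict K (all-but y) closed y-alive (λ y∈ → toWitnessFalse y∈ refl)
        (proj₁ (out₁-ok K y y-alive)) (fromWitnessFalse (proj₂ (out₁-ok K y y-alive)))
        (λ v∈ _ v≡root → toWitnessFalse v∈ (trans v≡root (sym y≡root)))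

  Replacement : Core → (x y y′ n : V) → Set
  Replacement K x y y′ n = (Arc K x n × n ≢ y) ⊎ n ≡ y′

  -- A subdivision after contraction lifts back by subdividing x → y′ at y.
  contract : ∀ K {x y y′} → Arc K x y → (∀ {u} → Arc K u y → u ≡ x) → y ≢ root K
           → Arc K y y′ → y′ ≢ x → (n₁ n₂ : V)
           → Replacement K x y y′ n₁ → (x ≢ root K → Replacement K x y y′ n₂ × n₁ ≢ n₂)
           → Reduction K
  contract K {x} {y} {y′} x→y only-x y≢root y→y′ y′≢x n₁ n₂ rep₁ rep₂ = record
    { smaller = K′
    ; shrinks = size-restrict K (all-but y) (proj₁ (arc-head K x→y)) (λ y∈ → toWitnessFalse y∈ refl)
    ; lift    = Lifting.lift-subdivision (Arc K) (Arc K′) (arc? K) new-arc x→y y→y′ y-sink }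
    where
    alive′ : V → Bool
    alive′ v = alive K v ∧ all-but y v

    out₁′ out₂′ : V → V
    out₁′ v with v ≟ x
    ... | yes _ = n₁
    ... | no  _ = out₁ K v
    out₂′ v with v ≟ x
    ... | yes _ = n₂
    ... | no  _ = out₂ K v

    avoids-y : ∀ {v w} → v ≢ x → Arc K v w → T (all-but y w)
    avoids-y v≢x v→w = fromWitnessFalse (λ { refl → v≢x (only-x v→w) })

    replacement-ok : ∀ {n} → Replacement K x y y′ n → T (alive′ n) × n ≢ x
    replacement-ok (inj₁ (x→n , n≢y)) =
      ∧-intro (proj₁ (arc-head K x→n)) (fromWitnessFalse n≢y) , proj₂ (arc-head K x→n)
    replacement-ok (inj₂ refl) =
      ∧-intro (proj₁ (arc-head K y→y′)) (fromWitnessFalse (proj₂ (arc-head K y→y′))) , y′≢x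

    out₁′-ok : ∀ v → T (alive′ v) → T (alive′ (out₁′ v)) × out₁′ v ≢ v
    out₁′-ok v al′ with v ≟ x
    ... | yes refl = replacement-ok rep₁
    ... | no v≢x   = ∧-intro (proj₁ (out₁-ok K v al)) (avoids-y v≢x (first-arc K al)) , proj₂ (out₁-ok K v al)
      where al = ∧-fst al′

    out₂′-ok : ∀ v → T (alive′ v) → v ≢ root K
             → T (alive′ (out₂′ v)) × out₂′ v ≢ v × out₁′ v ≢ out₂′ v
    out₂′-ok v al′ v≢root with v ≟ x
    ... | yes refl =
      let (rep , n₁≢n₂) = rep₂ v≢root ; (ok , n₂≢x) = replacement-ok rep in ok , n₂≢x , n₁≢n₂
    ... | no v≢x   =
      ∧-intro (proj₁ (out₂-ok K v al v≢root)) (avoids-y v≢x (second-arc K al v≢root))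
      , proj₂ (out₂-ok K v al v≢root)
      where al = ∧-fst al′

    K′ : Core
    K′ = record
      { alive = alive′ ; root = root K ; out₁ = out₁′ ; out₂ = out₂′
      ; root-alive = ∧-intro (root-alive K) (fromWitnessFalse (y≢root ∘ sym))
      ; out₁-ok = out₁′-ok ; out₂-ok = out₂′-ok }

    replacement-arc : ∀ {n} → Replacement K x y y′ n → Arc K x n ⊎ (x ≡ x × n ≡ y′)
    replacement-arc (inj₁ (x→n , _)) = inj₁ x→n
    replacement-arc (inj₂ n≡y′)      = inj₂ (refl , n≡y′)

    new-arc : ∀ {u w} → Arc K′ u w → Arc K u w ⊎ (u ≡ x × w ≡ y′)
    new-arc {u} (al′ , inj₁ refl) with u ≟ x
    ... | yes refl = replacement-arc rep₁
    ... | no _     = inj₁ (first-arc K (∧-fst al′))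
    new-arc {u} (al′ , inj₂ (u≢root , refl)) with u ≟ x
    ... | yes refl = replacement-arc (proj₁ (rep₂ u≢root))
    ... | no _     = inj₁ (second-arc K (∧-fst al′) u≢root)

    y-sink : ∀ {w} → ¬ Arc K′ y w
    y-sink (al′ , _) = toWitnessFalse (∧-snd {alive K y} al′) refl

  delete-root : ∀ K {x} → Arc K x (root K) → (∀ {u} → Arc K u (root K) → u ≡ x) → Reduction K
  delete-root K {x} x→root only-x = record
    { smaller = K′
    ; shrinks = size-restrict K (all-but (root K)) (root-alive K) (λ root∈ → toWitnessFalse root∈ refl)
    ; lift    = subdivision-map old-arc }
    where
    x≢root : x ≢ root K
    x≢root = proj₂ (arc-head K x→root) ∘ sym

    x₁ : V
    x₁ = proj₁ (other-out K x→root x≢root)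
    x→x₁ : Arc K x x₁
    x→x₁ = proj₁ (proj₂ (other-out K x→root x≢root))
    x₁≢root : x₁ ≢ root K
    x₁≢root = proj₂ (proj₂ (other-out K x→root x≢root))

    alive′ : V → Bool
    alive′ v = alive K v ∧ all-but (root K) v

    out₁′ : V → V
    out₁′ v with v ≟ x
    ... | yes _ = x₁
    ... | no  _ = out₁ K v

    avoids-root : ∀ {v w} → v ≢ x → Arc K v w → T (all-but (root K) w)
    avoids-root v≢x v→w = fromWitnessFalse (λ { refl → v≢x (only-x v→w) })

    out₁′-ok : ∀ v → T (alive′ v) → T (alive′ (out₁′ v)) × out₁′ v ≢ v
    out₁′-ok v al′ with v ≟ x
    ... | yes refl = ∧-intro (proj₁ (arc-head K x→x₁)) (fromWitnessFalse x₁≢root) , proj₂ (arc-head K x→x₁)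
    ... | no v≢x   = ∧-intro (proj₁ (out₁-ok K v al)) (avoids-root v≢x (first-arc K al)) , proj₂ (out₁-ok K v al)
      where al = ∧-fst al′

    out₂′-ok : ∀ v → T (alive′ v) → v ≢ x
             → T (alive′ (out₂ K v)) × out₂ K v ≢ v × out₁′ v ≢ out₂ K v
    out₂′-ok v al′ v≢x with v ≟ x
    ... | yes v≡x = ⊥-elim (v≢x v≡x)
    ... | no _    =
      ∧-intro (proj₁ (out₂-ok K v al v≢root)) (avoids-root v≢x (second-arc K al v≢root))
      , proj₂ (out₂-ok K v al v≢root)
      where
      al = ∧-fst al′
      v≢root = toWitnessFalse (∧-snd {alive K v} al′)

    K′ : Core
    K′ = record
      { alive = alive′ ; root = x ; out₁ = out₁′ ; out₂ = out₂ K
      ; root-alive = ∧-intro (proj₁ x→root) (fromWitnessFalse x≢root)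
      ; out₁-ok = out₁′-ok ; out₂-ok = out₂′-ok }

    old-arc : ∀ {u w} → Arc K′ u w → Arc K u w
    old-arc {u} (al′ , inj₁ refl) with u ≟ x
    ... | yes refl = x→x₁
    ... | no _     = first-arc K (∧-fst al′)
    old-arc {u} (al′ , inj₂ (_ , refl)) = second-arc K (∧-fst al′) (toWitnessFalse (∧-snd {alive K u} al′))

  -- Search from x₁ for x: a path
  -- x₁ ⇝ x gives a subdivision with branch vertices y, x, x₁; otherwise the
  -- vertices reachable from x₁ form an arc-closed set avoiding x.
  two-cycle-case : ∀ K {x y x₁} → Arc K x y → (∀ {u} → Arc K u y → u ≡ x)
                 → Arc K x x₁ → x₁ ≢ y → Arc K y x → Arc K y x₁
                 → Subdivision (Arc K) ⊎ Reduction K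
  two-cycle-case K {x} {y} {x₁} x→y only-x x→x₁ x₁≢y y→x y→x₁
    with Reachability.reachability (Arc K) (arc? K) x₁ x (proj₂ (arc-head K x→x₁))
  ... | inj₁ (ps , x₁⇝x , simple , x∉) = inj₁ (record
    { a = y ; b = x ; c = x₁ ; pab = [] ; pba = [] ; pbc = [] ; pcb = ps ; pac = []
    ; arcs-ab = y→x ; arcs-ba = x→y ; arcs-bc = x→x₁ ; arcs-cb = x₁⇝x ; arcs-ac = y→x₁
    ; distinct = subst (λ q → Unique (y ∷ x ∷ x₁ ∷ q)) (sym (++-identityʳ ps))
                   (unique-∷ y∉ (unique-∷ x∉ simple)) })
    where
    y∉ : y ∉ x ∷ x₁ ∷ ps
    y∉ (here y≡x)           = proj₂ (arc-head K x→y) y≡x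
    y∉ (there (here y≡x₁))  = x₁≢y (sym y≡x₁)
    y∉ (there (there y∈ps)) = avoids-via only-x ps x∉ x₁⇝x y∈ps
  ... | inj₂ (S , x₁∈S , x∉S , closed) with T? (S (root K))
  ...   | yes root∈S =
    inj₂ (restrict K S closed (proj₁ x→y) x∉S (root-alive K) root∈S (λ _ v≢root → v≢root))
  ...   | no root∉S  = inj₂ (restrict K S closed (proj₁ x→y) x∉S (proj₁ (arc-head K x→x₁)) x₁∈S
                          (λ v∈S _ v≡root → root∉S (subst (T ∘ S) v≡root v∈S)))

  single-in-neighbour : ∀ K {x y} → T (alive K y) → y ≢ root K → Arc K x y → (∀ {u} → Arc K u y → u ≡ x)
                      → Subdivision (Arc K) ⊎ Reduction K
  single-in-neighbour K {x} {y} y-alive y≢root x→y only-x with x ≟ root K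
  ... | yes refl with out-avoiding K y-alive y≢root (root K)
  ...   | y′ , y→y′ , y′≢root =
    inj₂ (contract K x→y only-x y≢root y→y′ y′≢root y′ y′ (inj₂ refl)
            (λ x≢root → ⊥-elim (x≢root refl)))
  single-in-neighbour K {x} {y} y-alive y≢root x→y only-x | no x≢root with other-out K x→y x≢root
  ... | x₁ , x→x₁ , x₁≢y with third-neighbour K y-alive y≢root x x₁
  ...   | inj₁ (y′ , y→y′ , y′≢x , y′≢x₁) =
    inj₂ (contract K x→y only-x y≢root y→y′ y′≢x x₁ y′ (inj₁ (x→x₁ , x₁≢y))
            (λ _ → inj₂ refl , y′≢x₁ ∘ sym))
  ...   | inj₂ (y→x , y→x₁) = two-cycle-case K x→y only-x x→x₁ x₁≢y y→x y→x₁

  reduce : ∀ K → Subdivision (Arc K) ⊎ Reduction K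
  reduce K with sparse-vertex K
  ... | y , y-alive , sparse with in-neighbours K y sparse
  ... | inj₁ no-in = inj₂ (delete-source K y-alive no-in)
  ... | inj₂ (x , x→y , only-x) with y ≟ root K
  ...   | yes refl  = inj₂ (delete-root K x→y only-x)
  ...   | no y≢root = single-in-neighbour K y-alive y≢root x→y only-x

  core-subdivision : ∀ K → Subdivision (Arc K)
  core-subdivision K = go K (<-wellFounded (size K))
    where
    go : ∀ K → Acc _<_ (size K) → Subdivision (Arc K)
    go K (acc smaller-size) with reduce K
    ... | inj₁ F   = F
    ... | inj₂ red = Reduction.lift red (go (Reduction.smaller red) (smaller-size (Reduction.shrinks red)))


-- From the digraph D to a core, and back to a subdivision in D

sum-tabulate : ∀ {n} (f : Fin n → ℕ) → sum (tabulate f) ≡ ∑ f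
sum-tabulate {zero}  f = refl
sum-tabulate {suc n} f = cong (f zero +_) (sum-tabulate (f ∘ suc))

outdeg-∑ : ∀ D v → outdeg D v ≡ ∑ (λ w → indicator (arc D v w))
outdeg-∑ D v = trans (cong sum (map-tabulate id v→)) (sum-tabulate v→)
  where
  v→ : Fin (n D) → ℕ
  v→ w = indicator (arc D v w)

loopless-arc : ∀ D {v w} → T (arc D v w) → w ≢ v
loopless-arc D {v} v→v refl = subst T (loopless D v) v→v

record OutChoice (D : Digraph) (v₀ v : Fin (n D)) : Set where
  field
    first second : Fin (n D)
    first-arc  : T (arc D v first)
    second-arc : v ≢ v₀ → T (arc D v second) × first ≢ second
open OutChoice

choose-out : ∀ D v₀ → 1 ≤ outdeg D v₀ → (∀ v → v ≢ v₀ → 2 ≤ outdeg D v) → ∀ v → OutChoice D v₀ v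
choose-out D v₀ deg₀ deg v with v ≟ v₀
... | yes refl with one-true (arc D v₀) (subst (1 ≤_) (outdeg-∑ D v₀) deg₀)
...   | w , v→w =
  record { first = w ; second = w ; first-arc = v→w ; second-arc = λ v≢v₀ → ⊥-elim (v≢v₀ refl) }
choose-out D v₀ deg₀ deg v | no v≢v₀ with two-true (arc D v) (subst (2 ≤_) (outdeg-∑ D v) (deg v v≢v₀))
... | w₁ , w₂ , w₁≢w₂ , v→w₁ , v→w₂ =
  record { first = w₁ ; second = w₂ ; first-arc = v→w₁ ; second-arc = λ _ → v→w₂ , w₁≢w₂ }

module _ (D : Digraph) (v₀ : Fin (n D)) (choice : ∀ v → OutChoice D v₀ v) where
  open Cores (n D) using (Core; Arc)

  initial-core : Core
  initial-core = record
    { alive = λ _ → true ; root = v₀ ; out₁ = first ∘ choice ; out₂ = second ∘ choice ; root-alive = tt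
    ; out₁-ok = λ v _ → tt , loopless-arc D (first-arc (choice v))
    ; out₂-ok = λ v _ v≢v₀ →
        tt , loopless-arc D (proj₁ (second-arc (choice v) v≢v₀)) , proj₂ (second-arc (choice v) v≢v₀) }

  initial-core-arc : ∀ {u w} → Arc initial-core u w → T (arc D u w)
  initial-core-arc (_ , inj₁ refl)            = first-arc (choice _)
  initial-core-arc (_ , inj₂ (u≢v₀ , refl)) = proj₁ (second-arc (choice _) u≢v₀)

to-PathArcs : ∀ D {s} ps {t} → Path (λ u w → T (arc D u w)) s ps t → PathArcs D s ps t
to-PathArcs D []       p        = p
to-PathArcs D (m ∷ ms) (sm , p) = sm , to-PathArcs D ms p

to-SubdivK3e : ∀ D → Subdivision (λ u w → T (arc D u w)) → SubdivK3e D
to-SubdivK3e D F = record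
  { a = a ; b = b ; c = c ; pab = pab ; pba = pba ; pbc = pbc ; pcb = pcb ; pac = pac
  ; arcs-ab = to-PathArcs D pab arcs-ab ; arcs-ba = to-PathArcs D pba arcs-ba ; arcs-bc = to-PathArcs D pbc arcs-bc
  ; arcs-cb = to-PathArcs D pcb arcs-cb ; arcs-ac = to-PathArcs D pac arcs-ac
  ; distinct = subst (λ q → Unique (a ∷ b ∷ c ∷ pab ++ pba ++ pbc ++ pcb ++ q)) (++-identityʳ pac) distinct }
  where open Subdivision F

proposition4p1 : (D : Digraph) (v₀ : Fin (n D))
    → 1 ≤ outdeg D v₀
    → (∀ (v : Fin (n D)) → v ≢ v₀ → 2 ≤ outdeg D v)
    → SubdivK3e D
proposition4p1 D v₀ deg₀ deg =
  to-SubdivK3e D (subdivision-map (initial-core-arc D v₀ choice) (core-subdivision (initial-core D v₀ choice)))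
  where
  open Cores (n D) using (core-subdivision)
  choice : ∀ v → OutChoice D v₀ v
  choice = choose-out D v₀ deg₀ deg
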